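{- Let $F,G\in\mathrm{sQSym}$ be homogeneous in the fermionic variables, of fermionic degrees $m_F$ and $m_G$ respectively. Then $$S(F\bullet G)=(-1)^{m_Fm_G}\big(S(G)\bullet S(F)+S(G)\odot S(F)\big)\quad\text{and}\quad S(F\odot G)=(-1)^{m_Fm_G-1}S(G)\odot S(F).$$
   Context: Variables: commuting $x_1,x_2,\dots$ and anticommuting $\theta_1,\theta_2,\dots$. A dotted composition is a finite sequence $\alpha=(\alpha_1,\dots,\alpha_l)$ with entries either positive integers (non-dotted) or dotted nonnegative integers $\dot0,\dot1,\dots$; $\ell(\alpha)=l$, $\eta_i=1$ if $\alpha_i$ is dotted and $0$ otherwise, and $m_\alpha$ (fermionic degree) is the number of dotted entries. $M_\alpha=\sum_{i_1<\cdots<i_l}\theta_{i_1}^{\eta_1}\cdots\theta_{i_l}^{\eta_l}x_{i_1}^{\alpha_1}\cdots x_{i_l}^{\alpha_l}$, $M_\emptyset=1$; the $M_\alpha$ form a basis of $\mathrm{sQSym}$. An element is homogeneous of fermionic degree $m$ if it is a linear combination of $M_\alpha$ with $m_\alpha=m$. Concatenation: $\alpha\cdot\beta=(\alpha_1,\dots,\alpha_k,\beta_1,\dots,\beta_r)$. Near concatenation (for nonempty $\alpha,\beta$ with $\alpha_k,\beta_1$ not both dotted): $\alpha\odot\beta=(\alpha_1,\dots,\alpha_{k-1},\alpha_k+\beta_1,\beta_2,\dots,\beta_r)$, the middle entry dotted iff one of $\alpha_k,\beta_1$ is dotted. Bilinear products: $M_\alpha\bullet M_\beta=M_{\alpha\cdot\beta}$;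 $M_\alpha\odot M_\beta=M_{\alpha\odot\beta}$ when defined, and $M_\alpha\odot M_\beta=0$ when the last entry of $\alpha$ and first entry of $\beta$ are both dotted or when $\alpha$ or $\beta$ is empty. The reverse of $\alpha$ is $\mathrm{Rev}(\alpha)=(\alpha_l,\dots,\alpha_1)$. The order $\trianglelefteq$ is the reflexive–transitive closure of: $\beta\trianglelefteq\alpha$ if $\alpha$ is obtained from $\beta$ by replacing two adjacent parts, at most one of which is dotted, by their sum (dotted iff one of the two parts is dotted); $\gamma\trianglerighteq\beta$ means $\beta\trianglelefteq\gamma$. The antipode $S$ of the Hopf algebra $\mathrm{sQSym}$ is the linear map with $S(M_\alpha)=(-1)^{\ell(\alpha)+\binom{m_\alpha}{2}}\sum_{\gamma\trianglerighteq\mathrm{Rev}(\alpha)}M_\gamma$. -}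

module Defs where

open import Level using (_⊔_)
open import Algebra.Bundles using (CommutativeRing)
open import Data.Nat using (ℕ; zero; suc; _+_)
open import Data.Nat.Combinatorics using (_C_)
open import Data.Bool using (if_then_else_)
open import Data.Maybe using (Maybe; just; nothing; maybe)
open import Data.Product using (_×_; _,_)
open import Data.List using (List; []; _∷_; _++_; map; concatMap; length; reverse; foldr; deduplicate)
import Data.List.Properties as LP
open import Relation.Binary.PropositionalEquality using (_≡_; _≢_; refl; cong)
open import Relation.Binary.Definitions using (DecidableEquality)
open import Relation.Nullary using (yes; no; does)
open import Relation.Nullary.Negation using (¬_)
import Data.Nat.Properties as NP

-- Parts of dotted compositions
--   nd k : the NON-dotted part whose value is the positive integer  suc k
--   dt k : the DOTTED part  k̇  (k ≥ 0)

data Part : Set where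
  nd : ℕ → Part
  dt : ℕ → Part

_≟P_ : DecidableEquality Part
nd a ≟P nd b with a NP.≟ b
... | yes refl = yes refl
... | no a≢b = no λ { refl → a≢b refl }
nd a ≟P dt b = no λ ()
dt a ≟P nd b = no λ ()
dt a ≟P dt b with a NP.≟ b
... | yes refl = yes refl
... | no a≢b = no λ { refl → a≢b refl }

DComp : Set
DComp = List Part

_≟D_ : DecidableEquality DComp
_≟D_ = LP.≡-dec _≟P_

fdeg : DComp → ℕ
fdeg [] = 0
fdeg (nd _ ∷ α) = fdeg α
fdeg (dt _ ∷ α) = suc (fdeg α)

merge : Part → Part → Maybe Part
merge (nd a) (nd b) = just (nd (suc (a + b)))   -- (a+1)+(b+1) = (suc (a+b)) + 1
merge (nd a) (dt b) = just (dt (suc a + b))     -- (a+1) + ḃ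
merge (dt a) (nd b) = just (dt (a + suc b))     -- ȧ + (b+1)
merge (dt a) (dt b) = nothing

nearConcat : DComp → DComp → Maybe DComp
nearConcat [] β = nothing
nearConcat (a ∷ α) [] = nothing
nearConcat (a ∷ []) (b ∷ β) = maybe (λ p → just (p ∷ β)) nothing (merge a b)
nearConcat (a ∷ a' ∷ α) (b ∷ β) = maybe (λ γ → just (a ∷ γ)) nothing (nearConcat (a' ∷ α) (b ∷ β))

steps : DComp → List DComp
steps [] = []
steps (a ∷ []) = []
steps (a ∷ b ∷ β) =
  maybe (λ p → (p ∷ β) ∷ []) [] (merge a b) ++ map (a ∷_) (steps (b ∷ β))

-- reflexive–transitive closure of one-step merging, using n as fuel
-- (each step lowers the length by one, so fuel = length β suffices)
reach : ℕ → DComp → List DComp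
reach zero β = β ∷ []
reach (suc n) β = β ∷ concatMap (reach n) (steps β)

coarsenings : DComp → List DComp
coarsenings β = deduplicate _≟D_ (reach (length β) β)

-- sQSym over a commutative ring R, as the free R-module on the M_α:
-- an element is a finite formal sum  Σ c·M_α  given by a list of (c , α).

module sQSym {c ℓ} (R : CommutativeRing c ℓ) where
  open CommutativeRing R renaming (_+_ to _+R_; _*_ to _*R_)

  Elem : Set c
  Elem = List (Carrier × DComp)

  coeff : Elem → DComp → Carrier
  coeff F γ = foldr (λ { (x , α) acc → if does (α ≟D γ) then x +R acc else acc }) 0# F

  -- equality in sQSym (the M_α form a basis)
  _≋_ : Elem → Elem → Set ℓ
  F ≋ G = ∀ γ → coeff F γ ≈ coeff G γ

  M : DComp → Elem
  M α = (1# , α) ∷ []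

  _⊕_ : Elem → Elem → Elem
  F ⊕ G = F ++ G

  scale : Carrier → Elem → Elem
  scale x F = map (λ { (y , α) → (x *R y , α) }) F

  neg1^ : ℕ → Carrier
  neg1^ zero = 1#
  neg1^ (suc n) = - neg1^ n

  Homogeneous : ℕ → Elem → Set ℓ
  Homogeneous m F = ∀ α → fdeg α ≢ m → coeff F α ≈ 0#

  _•_ : Elem → Elem → Elem
  F • G = concatMap (λ { (x , α) → map (λ { (y , β) → (x *R y , α ++ β) }) G }) F

  -- bilinear extension of  M_α ⊙ M_β = M_{α⊙β}  (0 when undefined)
  _⊙_ : Elem → Elem → Elem
  F ⊙ G = concatMap (λ { (x , α) → concatMap (λ { (y , β) →
            maybe (λ γ → (x *R y , γ) ∷ []) [] (nearConcat α β) }) G }) F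

  S : Elem → Elem
  S F = concatMap (λ { (x , α) →
          map (λ γ → (x *R neg1^ (length α + (fdeg α C 2)) , γ)) (coarsenings (reverse α)) }) F

{-# OPTIONS --safe #-}

-- Both identities are checked coefficientwise on basis elements, which suffices by bilinearity
-- and homogeneity (the sign depends only on the fermionic degrees). Since Rev(α·β) = Rev β · Rev α,
-- every coarsening of Rev(α·β) is, in exactly one way, δ·ε or δ ⊙ ε with δ ⊵ Rev β and ε ⊵ Rev α;
-- likewise the coarsenings of Rev(α ⊙ β) = Rev β ⊙ Rev α are exactly the δ ⊙ ε. Hence the sums
-- over coarsenings match term by term, and only the signs remain: ℓ is additive under · and drops
-- by one under ⊙, m is additive under both, and C(m+m′,2) = C(m,2) + C(m′,2) + m m′.

module Submission where

open import Defs
open import Level using (Level)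
open import Algebra.Bundles using (CommutativeRing)
import Algebra.Properties.CommutativeSemigroup as CommutativeSemigroupProperties
import Algebra.Properties.Ring as RingProperties
open import Data.Empty using (⊥-elim)
open import Data.List using (List; []; _∷_; _++_; _∷ʳ_; map; concatMap; length; reverse; deduplicate)
open import Data.List.Properties
  using (∷-injective; ++-cancelˡ; unfold-reverse; reverse-++; reverse-involutive; length-++)
open import Data.List.Membership.DecPropositional _≟D_ using (_∈?_)
open import Data.List.Membership.Propositional using (_∈_; _∉_; find; lose)
open import Data.List.Membership.Propositional.Properties
  using (∈-map⁺; ∈-map⁻; ∈-concatMap⁺; ∈-concatMap⁻; ∈-deduplicate⁻; ∈-deduplicate⁺)
open import Data.List.Relation.Unary.All using () renaming (lookup to All-lookup)
open import Data.List.Relation.Unary.AllPairs using (_∷_)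
open import Data.List.Relation.Unary.Any using (here; there)
open import Data.List.Relation.Unary.Unique.Propositional using (Unique)
open import Data.List.Relation.Unary.Unique.DecPropositional.Properties using (deduplicate-!)
open import Data.Maybe using (just; nothing; maybe)
open import Data.Nat using (ℕ; zero; suc; _+_; _*_; _≤_; z≤n; s≤s)
open import Data.Nat.Combinatorics using (_C_; nC1≡n; nCk+nC[k+1]≡[n+1]C[k+1])
open import Data.Nat.ListAction using (sum)
import Data.Nat.Properties as ℕ
open import Data.Nat.Tactic.RingSolver using (solve-∀)
open import Data.Product using (_×_; _,_; -,_; ∃-syntax; ∃₂; proj₁; proj₂)
open import Data.Sum using (_⊎_; inj₁; inj₂)
open import Function using (_∘_)
open import Relation.Binary.Construct.Closure.ReflexiveTransitive
  using (Star; _◅_; _◅◅_; gmap) renaming (ε to ε★)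
open import Relation.Binary.PropositionalEquality
  using (_≡_; _≢_; refl; sym; trans; cong; cong₂; subst; subst₂; module ≡-Reasoning)
import Relation.Binary.Reasoning.Setoid as SetoidReasoning
open import Relation.Nullary using (yes; no; ¬_)

variable
  a b d e p q r x : Part
  α β γ δ ε ζ δ′ ε′ : DComp
  n : ℕ

-- The value of a part plus its dottedness: additive under merging and, unlike the value (0̇ has
-- value 0), never zero.
weight : Part → ℕ
weight (nd k) = suc k
weight (dt k) = suc k

dotted : Part → ℕ
dotted (nd _) = 0
dotted (dt _) = 1

size : DComp → ℕ
size α = sum (map weight α)

fdeg-∷ : ∀ a α → fdeg (a ∷ α) ≡ dotted a + fdeg α
fdeg-∷ (nd _) α = refl
fdeg-∷ (dt _) α = refl

fdeg-++ : ∀ α β → fdeg (α ++ β) ≡ fdeg α + fdeg β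
fdeg-++ [] β = refl
fdeg-++ (nd _ ∷ α) β = fdeg-++ α β
fdeg-++ (dt _ ∷ α) β = cong suc (fdeg-++ α β)

weight+≢0 : ∀ a → weight a + n ≢ 0
weight+≢0 (nd _) ()
weight+≢0 (dt _) ()

part-≡ : weight a ≡ weight b → dotted a ≡ dotted b → a ≡ b
part-≡ {nd _} {nd _} refl refl = refl
part-≡ {dt _} {dt _} refl refl = refl
part-≡ {nd _} {dt _} _ ()
part-≡ {dt _} {nd _} _ ()

Adds : (Part → ℕ) → Part → Part → Part → Set
Adds h a b p = h p ≡ h a + h b

merge-sound : merge a b ≡ just p → Adds weight a b p × Adds dotted a b p
merge-sound {nd i} {nd j} refl = cong suc (sym (ℕ.+-suc i j)) , refl
merge-sound {nd i} {dt j} refl = cong suc (sym (ℕ.+-suc i j)) , refl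
merge-sound {dt i} {nd j} refl = refl , refl
merge-sound {dt i} {dt j} ()

dotted≤1 : ∀ a → dotted a ≤ 1
dotted≤1 (nd _) = z≤n
dotted≤1 (dt _) = s≤s z≤n

merge-defined : ∀ a b → dotted a + dotted b ≤ 1 → ∃[ p ] merge a b ≡ just p
merge-defined (nd _) (nd _) _ = -, refl
merge-defined (nd _) (dt _) _ = -, refl
merge-defined (dt _) (nd _) _ = -, refl
merge-defined (dt _) (dt _) (s≤s ())

merge-complete : Adds weight a b p → Adds dotted a b p → merge a b ≡ just p
merge-complete {a} {b} {p} w d with merge-defined a b (subst (_≤ 1) d (dotted≤1 p))
... | p′ , eq with merge-sound eq
... | w′ , d′ = trans eq (cong just (part-≡ (trans w′ (sym w)) (trans d′ (sym d))))

merge-comm : merge a b ≡ just p → merge b a ≡ just p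
merge-comm {a} {b} eq with merge-sound eq
... | w , d =
  merge-complete (trans w (ℕ.+-comm (weight a) (weight b))) (trans d (ℕ.+-comm (dotted a) (dotted b)))

merge-cancelˡ : merge a b ≡ just p → merge a d ≡ just p → b ≡ d
merge-cancelˡ {a} eq eq′ with merge-sound eq | merge-sound eq′
... | w , d | w′ , d′ =
  part-≡ (ℕ.+-cancelˡ-≡ (weight a) _ _ (trans (sym w) w′)) (ℕ.+-cancelˡ-≡ (dotted a) _ _ (trans (sym d) d′))

merge-weight-≢ : merge a b ≡ just p → weight a + 0 ≢ weight p + n
merge-weight-≢ {a} {b} {p} {n} m eq = weight+≢0 b (sym (ℕ.+-cancelˡ-≡ (weight a) _ _ (begin
  weight a + 0                ≡⟨ eq ⟩
  weight p + n                ≡⟨ cong (_+ n) (proj₁ (merge-sound m)) ⟩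
  weight a + weight b + n     ≡⟨ ℕ.+-assoc (weight a) (weight b) n ⟩
  weight a + (weight b + n)   ∎)))
  where open ≡-Reasoning

+-reassoc : ∀ {x d e t p q : ℕ} → t ≡ x + d → p ≡ d + e → q ≡ x + p → q ≡ t + e
+-reassoc {x} {d} {e} refl refl refl = sym (ℕ.+-assoc x d e)

merge-reassocˡ : merge d e ≡ just p → merge x p ≡ just q → ∃[ t ] merge x d ≡ just t × merge t e ≡ just q
merge-reassocˡ {d} {e} {p} {x} {q} mde mxp with merge-sound mde | merge-sound mxp
... | wp , dp | wq , dq with merge-defined x d x+d≤1
  where
  x+d≤1 : dotted x + dotted d ≤ 1
  x+d≤1 = ℕ.≤-trans (ℕ.+-monoʳ-≤ (dotted x) (subst (dotted d ≤_) (sym dp) (ℕ.m≤m+n _ _)))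
                    (subst (_≤ 1) dq (dotted≤1 q))
... | t , mxd with merge-sound mxd
... | wt , dt′ = t , mxd , merge-complete (+-reassoc wt wp wq) (+-reassoc dt′ dp dq)

merge-reassocʳ : merge x p ≡ just q → merge q e ≡ just r → ∃[ t ] merge p e ≡ just t × merge x t ≡ just r
merge-reassocʳ mxp mqe with merge-reassocˡ (merge-comm mxp) (merge-comm mqe)
... | t , mep , mtx = t , merge-comm mep , merge-comm mtx

-- The order ⊴ and the list of coarsenings

infix 4 _⊴_ _↝_

-- The paper's order β ⊴ γ, presented block by block rather than as a closure of single merges.
data _⊴_ : DComp → DComp → Set where
  []   : [] ⊴ []
  keep : β ⊴ γ → a ∷ β ⊴ a ∷ γ
  join : merge a p ≡ just q → β ⊴ p ∷ γ → a ∷ β ⊴ q ∷ γ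

⊴-refl : ∀ β → β ⊴ β
⊴-refl [] = []
⊴-refl (a ∷ β) = keep (⊴-refl β)

⊴-size : β ⊴ γ → size β ≡ size γ
⊴-size [] = refl
⊴-size (keep {a = a} c) = cong (weight a +_) (⊴-size c)
⊴-size (join {a} {p} {q} {β} {γ} m c) = begin
  weight a + size β              ≡⟨ cong (weight a +_) (⊴-size c) ⟩
  weight a + (weight p + size γ) ≡⟨ sym (ℕ.+-assoc (weight a) (weight p) (size γ)) ⟩
  weight a + weight p + size γ   ≡⟨ cong (_+ size γ) (sym (proj₁ (merge-sound m))) ⟩
  weight q + size γ              ∎
  where open ≡-Reasoning

⊴-fdeg : β ⊴ γ → fdeg β ≡ fdeg γ
⊴-fdeg [] = refl
⊴-fdeg (keep {β} {γ} {a} c) = begin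
  fdeg (a ∷ β)      ≡⟨ fdeg-∷ a β ⟩
  dotted a + fdeg β ≡⟨ cong (dotted a +_) (⊴-fdeg c) ⟩
  dotted a + fdeg γ ≡⟨ sym (fdeg-∷ a γ) ⟩
  fdeg (a ∷ γ)      ∎
  where open ≡-Reasoning
⊴-fdeg (join {a} {p} {q} {β} {γ} m c) = begin
  fdeg (a ∷ β)                     ≡⟨ fdeg-∷ a β ⟩
  dotted a + fdeg β                ≡⟨ cong (dotted a +_) (trans (⊴-fdeg c) (fdeg-∷ p γ)) ⟩
  dotted a + (dotted p + fdeg γ)   ≡⟨ sym (ℕ.+-assoc (dotted a) (dotted p) (fdeg γ)) ⟩
  dotted a + dotted p + fdeg γ     ≡⟨ cong (_+ fdeg γ) (sym (proj₂ (merge-sound m))) ⟩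
  dotted q + fdeg γ                ≡⟨ sym (fdeg-∷ q γ) ⟩
  fdeg (q ∷ γ)                     ∎
  where open ≡-Reasoning

⊴-++ : α ⊴ δ → β ⊴ ε → α ++ β ⊴ δ ++ ε
⊴-++ [] c = c
⊴-++ (keep c) c′ = keep (⊴-++ c c′)
⊴-++ (join m c) c′ = join m (⊴-++ c c′)

data _↝_ : DComp → DComp → Set where
  here  : merge a b ≡ just p → a ∷ b ∷ β ↝ p ∷ β
  there : β ↝ γ → a ∷ β ↝ a ∷ γ

↝-length : β ↝ γ → length β ≡ suc (length γ)
↝-length (here m) = refl
↝-length (there s) = cong suc (↝-length s)

↝-⊴-trans : β ↝ γ → γ ⊴ δ → β ⊴ δ
↝-⊴-trans (here m) (keep c) = join m (keep c)
↝-⊴-trans (here m) (join m′ c) with merge-reassocʳ m m′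
... | t , mbt , mat = join mat (join mbt c)
↝-⊴-trans (there s) (keep c) = keep (↝-⊴-trans s c)
↝-⊴-trans (there s) (join m c) = join m (↝-⊴-trans s c)

⊴⇒↝* : β ⊴ γ → Star _↝_ β γ
⊴⇒↝* [] = ε★
⊴⇒↝* (keep {a = a} c) = gmap (a ∷_) there (⊴⇒↝* c)
⊴⇒↝* (join {a} m c) = gmap (a ∷_) there (⊴⇒↝* c) ◅◅ (here m ◅ ε★)

∈-steps⁻ : ∀ β → γ ∈ steps β → β ↝ γ
∈-map-steps⁻ : ∀ a β → γ ∈ map (a ∷_) (steps β) → a ∷ β ↝ γ

∈-steps⁻ (a ∷ b ∷ β) γ∈ with merge a b in eq
... | nothing = ∈-map-steps⁻ a (b ∷ β) γ∈
... | just p with γ∈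
...   | here refl = here eq
...   | there γ∈′ = ∈-map-steps⁻ a (b ∷ β) γ∈′

∈-map-steps⁻ a β γ∈ with ∈-map⁻ (a ∷_) γ∈
... | γ′ , γ′∈ , refl = there (∈-steps⁻ β γ′∈)

∈-steps⁺ : β ↝ γ → γ ∈ steps β
∈-steps⁺ (here m) rewrite m = here refl
∈-steps⁺ (there {b ∷ β} {a = a} s) with merge a b
... | just _ = there (∈-map⁺ (a ∷_) (∈-steps⁺ s))
... | nothing = ∈-map⁺ (a ∷_) (∈-steps⁺ s)

∈-reach⁻ : ∀ n β → γ ∈ reach n β → β ⊴ γ
∈-reach⁻ zero β (here refl) = ⊴-refl β
∈-reach⁻ (suc n) β (here refl) = ⊴-refl β
∈-reach⁻ (suc n) β (there γ∈) with find (∈-concatMap⁻ (reach n) {xs = steps β} γ∈)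
... | β′ , β′∈ , γ∈′ = ↝-⊴-trans (∈-steps⁻ β β′∈) (∈-reach⁻ n β′ γ∈′)

↝*⇒∈-reach : Star _↝_ β γ → γ ∈ reach (length β) β
↝*⇒∈-reach {[]} ε★ = here refl
↝*⇒∈-reach {_ ∷ _} ε★ = here refl
↝*⇒∈-reach {β} (_◅_ {j = β′} s ss) rewrite ↝-length s =
  there (∈-concatMap⁺ (reach (length β′)) (lose (∈-steps⁺ s) (↝*⇒∈-reach ss)))

∈-coarsenings⁻ : γ ∈ coarsenings β → β ⊴ γ
∈-coarsenings⁻ {β = β} γ∈ = ∈-reach⁻ (length β) β (∈-deduplicate⁻ _≟D_ (reach (length β) β) γ∈)

∈-coarsenings⁺ : β ⊴ γ → γ ∈ coarsenings β
∈-coarsenings⁺ c = ∈-deduplicate⁺ _≟D_ (↝*⇒∈-reach (⊴⇒↝* c))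

coarsenings-unique : ∀ β → Unique (coarsenings β)
coarsenings-unique β = deduplicate-! _≟D_ (reach (length β) β)

data NearConcat : DComp → DComp → DComp → Set where
  seam : merge a b ≡ just p → NearConcat (a ∷ []) (b ∷ β) (p ∷ β)
  pass : NearConcat α β γ → NearConcat (a ∷ α) β (a ∷ γ)

nearConcat-∷ : ∀ α β → nearConcat α β ≡ just γ → nearConcat (a ∷ α) β ≡ just (a ∷ γ)
nearConcat-∷ [] β ()
nearConcat-∷ (_ ∷ _) [] ()
nearConcat-∷ (_ ∷ _) (_ ∷ _) eq rewrite eq = refl

NC⇒nearConcat : NearConcat α β γ → nearConcat α β ≡ just γ
NC⇒nearConcat (seam m) rewrite m = refl
NC⇒nearConcat (pass {α} {β} v) = nearConcat-∷ α β (NC⇒nearConcat v)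

nearConcat⇒NC : ∀ α β → nearConcat α β ≡ just γ → NearConcat α β γ
nearConcat⇒NC (a ∷ []) (b ∷ β) eq with merge a b in m
nearConcat⇒NC (a ∷ []) (b ∷ β) refl | just p = seam m
nearConcat⇒NC (a ∷ a′ ∷ α) (b ∷ β) eq with nearConcat (a′ ∷ α) (b ∷ β) in nc
nearConcat⇒NC (a ∷ a′ ∷ α) (b ∷ β) refl | just γ = pass (nearConcat⇒NC (a′ ∷ α) (b ∷ β) nc)

NC-deterministic : NearConcat α β γ → NearConcat α β δ → γ ≡ δ
NC-deterministic v w with trans (sym (NC⇒nearConcat v)) (NC⇒nearConcat w)
... | refl = refl

NC-at : ∀ α → merge a b ≡ just p → NearConcat (α ∷ʳ a) (b ∷ β) (α ++ p ∷ β)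
NC-at [] m = seam m
NC-at (_ ∷ α) m = pass (NC-at α m)

NC-∷ʳ : NearConcat α β γ → NearConcat α (β ∷ʳ d) (γ ∷ʳ d)
NC-∷ʳ (seam m) = seam m
NC-∷ʳ (pass v) = pass (NC-∷ʳ v)

NC-reverse : NearConcat α β γ → NearConcat (reverse β) (reverse α) (reverse γ)
NC-reverse (seam {a} {b} {p} {β} m) =
  subst₂ (λ β′ γ′ → NearConcat β′ (a ∷ []) γ′) (sym (unfold-reverse b β)) (sym (unfold-reverse p β))
    (NC-at (reverse β) (merge-comm m))
NC-reverse (pass {α} {β} {γ} {a} v) =
  subst₂ (NearConcat (reverse β)) (sym (unfold-reverse a α)) (sym (unfold-reverse a γ)) (NC-∷ʳ (NC-reverse v))

NC-reverse⁻ : ∀ α β → NearConcat (reverse β) (reverse α) γ → NearConcat α β (reverse γ)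
NC-reverse⁻ {γ} α β v =
  subst₂ (λ α′ β′ → NearConcat α′ β′ (reverse γ)) (reverse-involutive α) (reverse-involutive β) (NC-reverse v)

NC-length : NearConcat α β γ → suc (length γ) ≡ length α + length β
NC-length (seam m) = refl
NC-length (pass v) = cong suc (NC-length v)

NC-fdeg : NearConcat α β γ → fdeg γ ≡ fdeg α + fdeg β
NC-fdeg (seam {a} {b} {p} {β} m) = begin
  fdeg (p ∷ β)                   ≡⟨ fdeg-∷ p β ⟩
  dotted p + fdeg β              ≡⟨ cong (_+ fdeg β) (proj₂ (merge-sound m)) ⟩
  dotted a + dotted b + fdeg β   ≡⟨ ℕ.+-assoc (dotted a) (dotted b) (fdeg β) ⟩
  dotted a + (dotted b + fdeg β) ≡⟨ cong₂ _+_ (sym (trans (fdeg-∷ a []) (ℕ.+-identityʳ _))) (sym (fdeg-∷ b β)) ⟩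
  fdeg (a ∷ []) + fdeg (b ∷ β)   ∎
  where open ≡-Reasoning
NC-fdeg (pass {α} {β} {γ} {a} v) = begin
  fdeg (a ∷ γ)                   ≡⟨ fdeg-∷ a γ ⟩
  dotted a + fdeg γ              ≡⟨ cong (dotted a +_) (NC-fdeg v) ⟩
  dotted a + (fdeg α + fdeg β)   ≡⟨ sym (ℕ.+-assoc (dotted a) (fdeg α) (fdeg β)) ⟩
  dotted a + fdeg α + fdeg β     ≡⟨ cong (_+ fdeg β) (sym (fdeg-∷ a α)) ⟩
  fdeg (a ∷ α) + fdeg β          ∎
  where open ≡-Reasoning

NC⇒↝ : NearConcat α β γ → α ++ β ↝ γ
NC⇒↝ (seam m) = here m
NC⇒↝ (pass v) = there (NC⇒↝ v)

-- Factorising coarsenings of α · β and α ⊙ β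

++-cancel-size : ∀ δ δ′ → δ ++ ε ≡ δ′ ++ ε′ → size δ ≡ size δ′ → δ ≡ δ′
++-cancel-size [] [] _ _ = refl
++-cancel-size [] (a ∷ δ′) _ s = ⊥-elim (weight+≢0 a (sym s))
++-cancel-size (a ∷ δ) [] _ s = ⊥-elim (weight+≢0 a s)
++-cancel-size (a ∷ δ) (_ ∷ δ′) eq s with refl , eq′ ← ∷-injective eq =
  cong (a ∷_) (++-cancel-size δ δ′ eq′ (ℕ.+-cancelˡ-≡ (weight a) _ _ s))

++≢NC : ∀ δ → δ ++ ε ≡ γ → NearConcat δ′ ε′ γ → size δ ≢ size δ′
++≢NC [] refl (seam {a} m) s = weight+≢0 a (sym s)
++≢NC [] refl (pass {a = a} v) s = weight+≢0 a (sym s)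
++≢NC (d ∷ δ) refl (seam m) s = merge-weight-≢ m (sym s)
++≢NC (d ∷ δ) refl (pass v) s = ++≢NC δ refl v (ℕ.+-cancelˡ-≡ (weight d) _ _ s)

[-]-injective : size (a ∷ []) ≡ size (b ∷ []) → fdeg (a ∷ []) ≡ fdeg (b ∷ []) → a ≡ b
[-]-injective {a} {b} s f =
  part-≡ (ℕ.+-cancelʳ-≡ 0 _ _ s) (ℕ.+-cancelʳ-≡ 0 _ _ (trans (sym (fdeg-∷ a [])) (trans f (fdeg-∷ b []))))

-- The fermionic degree is needed: a merged part ṗ arises both as ȧ + b and as a + ḃ.
NC-unique : NearConcat δ ε γ → NearConcat δ′ ε′ γ → size δ ≡ size δ′ → fdeg δ ≡ fdeg δ′ → δ ≡ δ′ × ε ≡ ε′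
NC-unique (seam m) (seam m′) s f with refl ← [-]-injective s f = refl , cong (_∷ _) (merge-cancelˡ m m′)
NC-unique (seam m) (pass v′) s f = ⊥-elim (merge-weight-≢ m s)
NC-unique (pass v) (seam m′) s f = ⊥-elim (merge-weight-≢ m′ (sym s))
NC-unique (pass {α} {a = a} v) (pass {α′} v′) s f
  with refl , refl ← NC-unique v v′ (ℕ.+-cancelˡ-≡ (weight a) _ _ s)
                       (ℕ.+-cancelˡ-≡ (dotted a) _ _ (trans (sym (fdeg-∷ a α)) (trans f (fdeg-∷ a α′)))) = refl , refl

⊴-size-≡ : α ⊴ δ → α ⊴ δ′ → size δ ≡ size δ′
⊴-size-≡ c c′ = trans (sym (⊴-size c)) (⊴-size c′)

⊴-++-unique : α ⊴ δ → α ⊴ δ′ → δ ++ ε ≡ δ′ ++ ε′ → (δ , ε) ≡ (δ′ , ε′)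
⊴-++-unique {δ = δ} {δ′ = δ′} c c′ eq with refl ← ++-cancel-size δ δ′ eq (⊴-size-≡ c c′) =
  cong (δ ,_) (++-cancelˡ δ _ _ eq)

⊴-NC-unique : α ⊴ δ → α ⊴ δ′ → NearConcat δ ε γ → NearConcat δ′ ε′ γ → (δ , ε) ≡ (δ′ , ε′)
⊴-NC-unique c c′ v v′
  with refl , refl ← NC-unique v v′ (⊴-size-≡ c c′) (trans (sym (⊴-fdeg c)) (⊴-fdeg c′)) = refl

⊴-++≢NC : α ⊴ δ → α ⊴ δ′ → δ ++ ε ≡ γ → ¬ NearConcat δ′ ε′ γ
⊴-++≢NC {δ = δ} c c′ eq v = ++≢NC δ eq v (⊴-size-≡ c c′)

⊴-NC : α ⊴ δ → β ⊴ ε → NearConcat δ ε γ → ∃[ ζ ] NearConcat α β ζ × ζ ⊴ γ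
⊴-NC (keep []) (keep cβ) (seam m) = -, seam m , keep cβ
⊴-NC (keep []) (join m′ cβ) (seam m) with merge-reassocˡ m′ m
... | t , mat , mte = -, seam mat , join mte cβ
⊴-NC (join m cα) cβ (seam m′) with merge-reassocʳ m m′
... | t , mpt , mat with ⊴-NC cα cβ (seam mpt)
...   | ζ , v , c = -, pass v , join mat c
⊴-NC (keep cα) cβ (pass v) with ⊴-NC cα cβ v
... | ζ , v′ , c = -, pass v′ , keep c
⊴-NC (join m cα) cβ (pass v) with ⊴-NC cα cβ (pass v)
... | ζ , v′ , c = -, pass v′ , join m c

⊴-NC-++ : α ⊴ δ → β ⊴ ε → NearConcat δ ε γ → α ++ β ⊴ γ
⊴-NC-++ cα cβ v with ⊴-NC cα cβ v
... | ζ , v′ , c = ↝-⊴-trans (NC⇒↝ v′) c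

⊴-split-++ : ∀ α → α ++ β ⊴ γ →
  (∃₂ λ δ ε → α ⊴ δ × β ⊴ ε × δ ++ ε ≡ γ) ⊎ (∃₂ λ δ ε → α ⊴ δ × β ⊴ ε × NearConcat δ ε γ)
⊴-split-++ [] c = inj₁ (-, -, [] , c , refl)
⊴-split-++ (a ∷ α) (keep c) with ⊴-split-++ α c
... | inj₁ (δ , ε , cα , cβ , refl) = inj₁ (-, -, keep cα , cβ , refl)
... | inj₂ (δ , ε , cα , cβ , v) = inj₂ (-, -, keep cα , cβ , pass v)
⊴-split-++ (a ∷ α) (join m c) with ⊴-split-++ α c
... | inj₁ ([] , ε , [] , cβ , refl) = inj₂ (-, -, keep [] , cβ , seam m)
... | inj₁ (_ ∷ δ , ε , cα , cβ , refl) = inj₁ (-, -, join m cα , cβ , refl)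
... | inj₂ (δ , ε , cα , cβ , seam m′) with merge-reassocˡ m′ m
...   | t , mat , mte = inj₂ (-, -, join mat cα , cβ , seam mte)
⊴-split-++ (a ∷ α) (join m c) | inj₂ (δ , ε , cα , cβ , pass v) = inj₂ (-, -, join m cα , cβ , pass v)

⊴-split-NC : NearConcat α β ζ → ζ ⊴ γ → ∃₂ λ δ ε → α ⊴ δ × β ⊴ ε × NearConcat δ ε γ
⊴-split-NC (seam m) (keep c) = -, -, keep [] , keep c , seam m
⊴-split-NC (seam m) (join m′ c) with merge-reassocʳ m m′
... | t , mbt , mat = -, -, keep [] , join mbt c , seam mat
⊴-split-NC (pass v) (keep c) with ⊴-split-NC v c
... | δ , ε , cα , cβ , v′ = -, -, keep cα , cβ , pass v′
⊴-split-NC (pass v) (join m c) with ⊴-split-NC v c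
... | δ , ε , cα , cβ , seam m′ with merge-reassocˡ m′ m
...   | t , mat , mte = -, -, join mat cα , cβ , seam mte
⊴-split-NC (pass v) (join m c) | δ , ε , cα , cβ , pass v′ = -, -, join m cα , cβ , pass v′

C2-+ : ∀ a b → (a + b) C 2 ≡ a C 2 + b C 2 + a * b
C2-+ zero b = sym (ℕ.+-identityʳ _)
C2-+ (suc a) b = begin
  suc (a + b) C 2                   ≡⟨ sym (nCk+nC[k+1]≡[n+1]C[k+1] (a + b) 1) ⟩
  (a + b) C 1 + (a + b) C 2         ≡⟨ cong₂ _+_ (nC1≡n (a + b)) (C2-+ a b) ⟩
  a + b + (a C 2 + b C 2 + a * b)   ≡⟨ regroup a b (a C 2) (b C 2) (a * b) ⟩
  a + a C 2 + b C 2 + (b + a * b)   ≡⟨ cong (λ z → z + b C 2 + (b + a * b)) suc-a-C2 ⟩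
  suc a C 2 + b C 2 + suc a * b     ∎
  where
  open ≡-Reasoning
  regroup : ∀ a b A B Q → a + b + (A + B + Q) ≡ a + A + B + (b + Q)
  regroup = solve-∀
  suc-a-C2 : a + a C 2 ≡ suc a C 2
  suc-a-C2 = trans (cong (_+ a C 2) (sym (nC1≡n a))) (nCk+nC[k+1]≡[n+1]C[k+1] a 1)

exponent-split : ∀ k l la lb ma mb → l + k ≡ la + lb →
  k + k + (l + (ma + mb) C 2) ≡ (ma * mb + k) + ((lb + mb C 2) + (la + ma C 2))
exponent-split k l la lb ma mb e = begin
  k + k + (l + (ma + mb) C 2)                        ≡⟨ cong (λ z → k + k + (l + z)) (C2-+ ma mb) ⟩
  k + k + (l + (ma C 2 + mb C 2 + ma * mb))          ≡⟨ regroup k l (ma C 2) (mb C 2) (ma * mb) ⟩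
  k + (l + k + (ma C 2 + mb C 2 + ma * mb))          ≡⟨ cong (λ z → k + (z + (ma C 2 + mb C 2 + ma * mb))) e ⟩
  k + (la + lb + (ma C 2 + mb C 2 + ma * mb))        ≡⟨ regroup′ k la lb (ma C 2) (mb C 2) (ma * mb) ⟩
  (ma * mb + k) + ((lb + mb C 2) + (la + ma C 2))    ∎
  where
  open ≡-Reasoning
  regroup : ∀ k l A B Q → k + k + (l + (A + B + Q)) ≡ k + (l + k + (A + B + Q))
  regroup = solve-∀
  regroup′ : ∀ k la lb A B Q → k + (la + lb + (A + B + Q)) ≡ (Q + k) + ((lb + B) + (la + A))
  regroup′ = solve-∀

module Antipode {c ℓ} (R : CommutativeRing c ℓ) where

  open CommutativeRing R
    renaming (_+_ to _+R_; _*_ to _*R_; refl to ≈-refl; sym to ≈-sym; trans to ≈-trans)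
  open RingProperties ring using (-‿distribˡ-*; -‿involutive)
  open CommutativeSemigroupProperties +-commutativeSemigroup using (interchange)
  open CommutativeSemigroupProperties *-commutativeSemigroup using (x∙yz≈y∙xz)
  open sQSym R
  open SetoidReasoning setoid

  private variable
    i : Level
    A B : Set i

  ∑ : List A → (A → Carrier) → Carrier
  ∑ [] f = 0#
  ∑ (x ∷ xs) f = f x +R ∑ xs f

  ∑-cong : ∀ xs {f g : A → Carrier} → (∀ x → f x ≈ g x) → ∑ xs f ≈ ∑ xs g
  ∑-cong [] _ = ≈-refl
  ∑-cong (x ∷ xs) f≈g = +-cong (f≈g x) (∑-cong xs f≈g)

  ∑-++ : ∀ xs {ys} (f : A → Carrier) → ∑ (xs ++ ys) f ≈ ∑ xs f +R ∑ ys f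
  ∑-++ [] f = ≈-sym (+-identityˡ _)
  ∑-++ (x ∷ xs) f = ≈-trans (+-congˡ (∑-++ xs f)) (≈-sym (+-assoc _ _ _))

  ∑-map : ∀ (g : B → A) xs (f : A → Carrier) → ∑ (map g xs) f ≡ ∑ xs (f ∘ g)
  ∑-map g [] f = refl
  ∑-map g (x ∷ xs) f = cong (f (g x) +R_) (∑-map g xs f)

  ∑-concatMap : ∀ {g : B → List A} xs {f} → ∑ (concatMap g xs) f ≈ ∑ xs (λ x → ∑ (g x) f)
  ∑-concatMap [] = ≈-refl
  ∑-concatMap {g = g} (x ∷ xs) {f} = ≈-trans (∑-++ (g x) f) (+-congˡ (∑-concatMap xs))

  ∑-+ : ∀ xs (f g : A → Carrier) → ∑ xs (λ x → f x +R g x) ≈ ∑ xs f +R ∑ xs g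
  ∑-+ [] f g = ≈-sym (+-identityˡ 0#)
  ∑-+ (x ∷ xs) f g = ≈-trans (+-congˡ (∑-+ xs f g)) (interchange _ _ _ _)

  ∑-*ˡ : ∀ xs k (f : A → Carrier) → ∑ xs (λ x → k *R f x) ≈ k *R ∑ xs f
  ∑-*ˡ [] k f = ≈-sym (zeroʳ k)
  ∑-*ˡ (x ∷ xs) k f = ≈-trans (+-congˡ (∑-*ˡ xs k f)) (≈-sym (distribˡ k _ _))

  ∑-zero : ∀ xs {f : A → Carrier} → (∀ {x} → x ∈ xs → f x ≈ 0#) → ∑ xs f ≈ 0#
  ∑-zero [] _ = ≈-refl
  ∑-zero (x ∷ xs) f≈0 = ≈-trans (+-cong (f≈0 (here refl)) (∑-zero xs (f≈0 ∘ there))) (+-identityˡ 0#)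

  ∑-unique : ∀ {xs x₀} {f : A → Carrier} → Unique xs → x₀ ∈ xs →
    (∀ {x} → x ∈ xs → x ≢ x₀ → f x ≈ 0#) → ∑ xs f ≈ f x₀
  ∑-unique {xs = x ∷ xs} (x∉xs ∷ _) (here refl) f≈0 =
    ≈-trans (+-congˡ (∑-zero xs (λ x′∈ → f≈0 (there x′∈) (λ { refl → All-lookup x∉xs x′∈ refl })))) (+-identityʳ _)
  ∑-unique {xs = x ∷ xs} (x∉xs ∷ u) (there x₀∈) f≈0 =
    ≈-trans (+-congʳ (f≈0 (here refl) (λ { refl → All-lookup x∉xs x₀∈ refl })))
      (≈-trans (+-identityˡ _) (∑-unique u x₀∈ (f≈0 ∘ there)))

  ∑-swap : ∀ xs (ys : List B) (h : A → B → Carrier) →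
    ∑ xs (λ x → ∑ ys (h x)) ≈ ∑ ys (λ y → ∑ xs (λ x → h x y))
  ∑-swap [] ys h = ≈-sym (∑-zero ys (λ _ → ≈-refl))
  ∑-swap (x ∷ xs) ys h = ≈-trans (+-congˡ (∑-swap xs ys h)) (≈-sym (∑-+ ys (h x) _))

  -- Pairing with functions on compositions

  -- M* γ is the functional dual to M_γ, so ≋ can be tested by pairing with every M* γ.
  ⟨_∣_⟩ : Elem → (DComp → Carrier) → Carrier
  ⟨ F ∣ f ⟩ = ∑ F (λ (x , α) → x *R f α)

  M* : DComp → DComp → Carrier
  M* γ α with α ≟D γ
  ... | yes _ = 1#
  ... | no _ = 0#

  M*-self : ∀ γ → M* γ γ ≈ 1#
  M*-self γ with γ ≟D γ
  ... | yes _ = ≈-refl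
  ... | no γ≢γ = ⊥-elim (γ≢γ refl)

  M*-other : α ≢ γ → M* γ α ≈ 0#
  M*-other {α} {γ} α≢γ with α ≟D γ
  ... | yes α≡γ = ⊥-elim (α≢γ α≡γ)
  ... | no _ = ≈-refl

  coeff-pairing : ∀ F γ → coeff F γ ≈ ⟨ F ∣ M* γ ⟩
  coeff-pairing [] γ = ≈-refl
  coeff-pairing ((x , α) ∷ F) γ with α ≟D γ
  ... | yes _ = +-cong (≈-sym (*-identityʳ x)) (coeff-pairing F γ)
  ... | no _ = ≈-trans (coeff-pairing F γ) (≈-sym (≈-trans (+-congʳ (zeroʳ x)) (+-identityˡ _)))

  ≋-by-pairing : ∀ F G → (∀ γ → ⟨ F ∣ M* γ ⟩ ≈ ⟨ G ∣ M* γ ⟩) → F ≋ G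
  ≋-by-pairing F G F≈G γ = ≈-trans (coeff-pairing F γ) (≈-trans (F≈G γ) (≈-sym (coeff-pairing G γ)))

  pairing-cong : ∀ F {f g} → (∀ α → f α ≈ g α) → ⟨ F ∣ f ⟩ ≈ ⟨ F ∣ g ⟩
  pairing-cong F f≈g = ∑-cong F (λ (x , α) → *-congˡ (f≈g α))

  pairing-+ : ∀ F f g → ⟨ F ∣ (λ α → f α +R g α) ⟩ ≈ ⟨ F ∣ f ⟩ +R ⟨ F ∣ g ⟩
  pairing-+ F f g = ≈-trans (∑-cong F (λ (x , α) → distribˡ x (f α) (g α))) (∑-+ F _ _)

  pairing-*ˡ : ∀ F k f → ⟨ F ∣ (λ α → k *R f α) ⟩ ≈ k *R ⟨ F ∣ f ⟩
  pairing-*ˡ F k f = ≈-trans (∑-cong F (λ (x , α) → x∙yz≈y∙xz x k (f α))) (∑-*ˡ F k _)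

  pairing-⊕ : ∀ F G f → ⟨ F ⊕ G ∣ f ⟩ ≈ ⟨ F ∣ f ⟩ +R ⟨ G ∣ f ⟩
  pairing-⊕ F G f = ∑-++ F _

  pairing-scale : ∀ k F f → ⟨ scale k F ∣ f ⟩ ≈ k *R ⟨ F ∣ f ⟩
  pairing-scale k F f = begin
    ⟨ scale k F ∣ f ⟩                       ≡⟨ ∑-map _ F _ ⟩
    ∑ F (λ (y , α) → (k *R y) *R f α)      ≈⟨ ∑-cong F (λ (y , α) → *-assoc k y (f α)) ⟩
    ∑ F (λ (y , α) → k *R (y *R f α))      ≈⟨ ∑-*ˡ F k _ ⟩
    k *R ⟨ F ∣ f ⟩                          ∎

  ∑-pairing : ∀ (xs : List A) F (h : A → DComp → Carrier) →
    ∑ xs (λ x → ⟨ F ∣ h x ⟩) ≈ ⟨ F ∣ (λ α → ∑ xs (λ x → h x α)) ⟩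
  ∑-pairing xs F h = ≈-trans (∑-swap xs F _) (∑-cong F (λ (y , α) → ∑-*ˡ xs y (λ x → h x α)))

  pairing-swap : ∀ F G (h : DComp → DComp → Carrier) →
    ⟨ G ∣ (λ β → ⟨ F ∣ h β ⟩) ⟩ ≈ ⟨ F ∣ (λ α → ⟨ G ∣ (λ β → h β α) ⟩) ⟩
  pairing-swap F G h =
    ≈-trans (∑-cong G (λ (y , β) → ≈-sym (pairing-*ˡ F y (h β)))) (∑-pairing G F (λ (y , β) α → y *R h β α))

  sign : DComp → Carrier
  sign α = neg1^ (length α + fdeg α C 2)

  -- The transposes of S, •, ⊙ and of (F , G) ↦ S G ⋆ S F for ⋆ ∈ {•, ⊙}.
  Sᵀ : (DComp → Carrier) → DComp → Carrier
  Sᵀ f α = sign α *R ∑ (coarsenings (reverse α)) f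

  •ᵀ ⊙ᵀ : (DComp → Carrier) → DComp → DComp → Carrier
  •ᵀ f α β = f (α ++ β)
  ⊙ᵀ f α β = maybe f 0# (nearConcat α β)

  Sᵀ₂ : (DComp → DComp → Carrier) → DComp → DComp → Carrier
  Sᵀ₂ h α β = Sᵀ (λ δ → Sᵀ (h δ) α) β

  ⟨_⊗_∣_⟩ : Elem → Elem → (DComp → DComp → Carrier) → Carrier
  ⟨ F ⊗ G ∣ h ⟩ = ⟨ F ∣ (λ α → ⟨ G ∣ h α ⟩) ⟩

  pairing-S : ∀ F f → ⟨ S F ∣ f ⟩ ≈ ⟨ F ∣ Sᵀ f ⟩
  pairing-S F f = ≈-trans (∑-concatMap F) (∑-cong F (λ (x , α) → begin
    ∑ (map (λ γ → (x *R sign α , γ)) (coarsenings (reverse α))) _    ≡⟨ ∑-map _ (coarsenings (reverse α)) _ ⟩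
    ∑ (coarsenings (reverse α)) (λ γ → (x *R sign α) *R f γ)         ≈⟨ ∑-*ˡ (coarsenings (reverse α)) _ f ⟩
    (x *R sign α) *R ∑ (coarsenings (reverse α)) f                   ≈⟨ *-assoc x (sign α) _ ⟩
    x *R Sᵀ f α                                                       ∎))

  pairing-• : ∀ F G f → ⟨ F • G ∣ f ⟩ ≈ ⟨ F ⊗ G ∣ •ᵀ f ⟩
  pairing-• F G f = ≈-trans (∑-concatMap F) (∑-cong F (λ (x , α) → begin
    ∑ (map (λ (y , β) → (x *R y , α ++ β)) G) _     ≡⟨ ∑-map _ G _ ⟩
    ∑ G (λ (y , β) → (x *R y) *R f (α ++ β))        ≈⟨ ∑-cong G (λ (y , β) → *-assoc x y _) ⟩
    ∑ G (λ (y , β) → x *R (y *R f (α ++ β)))        ≈⟨ ∑-*ˡ G x _ ⟩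
    x *R ⟨ G ∣ •ᵀ f α ⟩                              ∎))

  pairing-⊙ : ∀ F G f → ⟨ F ⊙ G ∣ f ⟩ ≈ ⟨ F ⊗ G ∣ ⊙ᵀ f ⟩
  pairing-⊙ F G f = ≈-trans (∑-concatMap F) (∑-cong F (λ (x , α) → begin
    ∑ (concatMap _ G) _                            ≈⟨ ∑-concatMap G ⟩
    ∑ G (λ (y , β) → ∑ (term (x *R y) α β) _)      ≈⟨ ∑-cong G (λ (y , β) → ∑-term (x *R y) α β) ⟩
    ∑ G (λ (y , β) → (x *R y) *R ⊙ᵀ f α β)         ≈⟨ ∑-cong G (λ (y , β) → *-assoc x y _) ⟩
    ∑ G (λ (y , β) → x *R (y *R ⊙ᵀ f α β))         ≈⟨ ∑-*ˡ G x _ ⟩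
    x *R ⟨ G ∣ ⊙ᵀ f α ⟩                             ∎))
    where
    term : Carrier → DComp → DComp → Elem
    term k α β = maybe (λ γ → (k , γ) ∷ []) [] (nearConcat α β)
    ∑-term : ∀ k α β → ⟨ term k α β ∣ f ⟩ ≈ k *R ⊙ᵀ f α β
    ∑-term k α β with nearConcat α β
    ... | just γ = +-identityʳ _
    ... | nothing = ≈-sym (zeroʳ k)

  Sᵀ-pairing : ∀ F (h : DComp → DComp → Carrier) β →
    Sᵀ (λ δ → ⟨ F ∣ h δ ⟩) β ≈ ⟨ F ∣ (λ α → Sᵀ (λ δ → h δ α) β) ⟩
  Sᵀ-pairing F h β = ≈-trans (*-congˡ (∑-pairing (coarsenings (reverse β)) F h)) (≈-sym (pairing-*ˡ F (sign β) _))

  pairing-S⊗S : ∀ F G h → ⟨ S G ⊗ S F ∣ h ⟩ ≈ ⟨ F ⊗ G ∣ Sᵀ₂ h ⟩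
  pairing-S⊗S F G h = begin
    ⟨ S G ∣ (λ δ → ⟨ S F ∣ h δ ⟩) ⟩                        ≈⟨ pairing-cong (S G) (λ δ → pairing-S F (h δ)) ⟩
    ⟨ S G ∣ (λ δ → ⟨ F ∣ Sᵀ (h δ) ⟩) ⟩                     ≈⟨ pairing-S G _ ⟩
    ⟨ G ∣ Sᵀ (λ δ → ⟨ F ∣ Sᵀ (h δ) ⟩) ⟩                    ≈⟨ pairing-cong G (Sᵀ-pairing F (λ δ → Sᵀ (h δ))) ⟩
    ⟨ G ∣ (λ β → ⟨ F ∣ (λ α → Sᵀ₂ h α β) ⟩) ⟩              ≈⟨ pairing-swap F G (λ β α → Sᵀ₂ h α β) ⟩
    ⟨ F ⊗ G ∣ Sᵀ₂ h ⟩                                      ∎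

  pairing⊗-*ˡ : ∀ F G k h → ⟨ F ⊗ G ∣ (λ α β → k *R h α β) ⟩ ≈ k *R ⟨ F ⊗ G ∣ h ⟩
  pairing⊗-*ˡ F G k h = ≈-trans (pairing-cong F (λ α → pairing-*ˡ G k (h α))) (pairing-*ˡ F k _)

  pairing⊗-+ : ∀ F G h k → ⟨ F ⊗ G ∣ (λ α β → h α β +R k α β) ⟩ ≈ ⟨ F ⊗ G ∣ h ⟩ +R ⟨ F ⊗ G ∣ k ⟩
  pairing⊗-+ F G h k = ≈-trans (pairing-cong F (λ α → pairing-+ G (h α) (k α))) (pairing-+ F _ _)

  coeff-∷ : ∀ x β F α → coeff ((x , β) ∷ F) α ≈ x *R M* α β +R coeff F α
  coeff-∷ x β F α = ≈-trans (coeff-pairing ((x , β) ∷ F) α) (+-congˡ (≈-sym (coeff-pairing F α)))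

  pairing-by-coeff : ∀ F f {K} → Unique K → (∀ {x α} → (x , α) ∈ F → α ∈ K) →
    ⟨ F ∣ f ⟩ ≈ ∑ K (λ α → coeff F α *R f α)
  pairing-by-coeff [] f {K} _ _ = ≈-sym (∑-zero K (λ {α} _ → zeroˡ (f α)))
  pairing-by-coeff ((x , β) ∷ F) f {K} K! F⊆K = begin
    x *R f β +R ⟨ F ∣ f ⟩
      ≈⟨ +-cong (≈-sym head) (pairing-by-coeff F f K! (F⊆K ∘ there)) ⟩
    ∑ K (λ α → x *R M* α β *R f α) +R ∑ K (λ α → coeff F α *R f α)
      ≈⟨ ∑-+ K _ _ ⟨
    ∑ K (λ α → x *R M* α β *R f α +R coeff F α *R f α)
      ≈⟨ ∑-cong K (λ α → ≈-sym (≈-trans (*-congʳ (coeff-∷ x β F α)) (distribʳ (f α) _ _))) ⟩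
    ∑ K (λ α → coeff ((x , β) ∷ F) α *R f α) ∎
    where
    off : ∀ {α} → α ∈ K → α ≢ β → x *R M* α β *R f α ≈ 0#
    off _ α≢β = ≈-trans (*-congʳ (≈-trans (*-congˡ (M*-other (α≢β ∘ sym))) (zeroʳ x))) (zeroˡ _)
    head : ∑ K (λ α → x *R M* α β *R f α) ≈ x *R f β
    head = begin
      ∑ K (λ α → x *R M* α β *R f α)   ≈⟨ ∑-unique K! (F⊆K (here refl)) off ⟩
      x *R M* β β *R f β               ≈⟨ *-congʳ (≈-trans (*-congˡ (M*-self β)) (*-identityʳ x)) ⟩
      x *R f β                         ∎

  pairing-homogeneous : ∀ {m} F {f g} → Homogeneous m F → (∀ α → fdeg α ≡ m → f α ≈ g α) →
    ⟨ F ∣ f ⟩ ≈ ⟨ F ∣ g ⟩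
  pairing-homogeneous {m} F {f} {g} hom f≈g = begin
    ⟨ F ∣ f ⟩                        ≈⟨ pairing-by-coeff F f K! F⊆K ⟩
    ∑ K (λ α → coeff F α *R f α)     ≈⟨ ∑-cong K agree ⟩
    ∑ K (λ α → coeff F α *R g α)     ≈⟨ pairing-by-coeff F g K! F⊆K ⟨
    ⟨ F ∣ g ⟩                        ∎
    where
    K = deduplicate _≟D_ (map proj₂ F)
    K! = deduplicate-! _≟D_ (map proj₂ F)
    F⊆K : ∀ {x α} → (x , α) ∈ F → α ∈ K
    F⊆K x,α∈F = ∈-deduplicate⁺ _≟D_ (∈-map⁺ proj₂ x,α∈F)
    agree : ∀ α → coeff F α *R f α ≈ coeff F α *R g α
    agree α with fdeg α ℕ.≟ m
    ... | yes e = *-congˡ (f≈g α e)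
    ... | no ne = begin
      coeff F α *R f α   ≈⟨ ≈-trans (*-congʳ (hom α ne)) (zeroˡ (f α)) ⟩
      0#                 ≈⟨ ≈-trans (*-congʳ (hom α ne)) (zeroˡ (g α)) ⟨
      coeff F α *R g α   ∎

  pairing⊗-homogeneous : ∀ {mF mG} F G {h k} → Homogeneous mF F → Homogeneous mG G →
    (∀ α β → fdeg α ≡ mF → fdeg β ≡ mG → h α β ≈ k α β) → ⟨ F ⊗ G ∣ h ⟩ ≈ ⟨ F ⊗ G ∣ k ⟩
  pairing⊗-homogeneous F G hF hG h≈k =
    pairing-homogeneous F hF (λ α eα → pairing-homogeneous G hG (λ β eβ → h≈k α β eα eβ))

  -- Counting coarsenings

  ∑-M*-∈ : ∀ {L γ} → Unique L → γ ∈ L → ∑ L (M* γ) ≈ 1#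
  ∑-M*-∈ {γ = γ} L! γ∈L = ≈-trans (∑-unique L! γ∈L (λ _ → M*-other)) (M*-self γ)

  ∑-M*-∉ : ∀ {L γ} → γ ∉ L → ∑ L (M* γ) ≈ 0#
  ∑-M*-∉ {L} {γ} γ∉L = ∑-zero L (λ {α} α∈L → M*-other {α} {γ} (λ { refl → γ∉L α∈L }))

  ⊙ᵀ-NC : ∀ f → NearConcat α β γ → ⊙ᵀ f α β ≡ f γ
  ⊙ᵀ-NC f v = cong (maybe f 0#) (NC⇒nearConcat v)

  ⊙ᵀ-zero : ∀ f α β → (∀ {γ} → NearConcat α β γ → f γ ≈ 0#) → ⊙ᵀ f α β ≈ 0#
  ⊙ᵀ-zero f α β f≈0 with nearConcat α β in eq
  ... | just γ = f≈0 (nearConcat⇒NC α β eq)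
  ... | nothing = ≈-refl

  ∑⊴₂ : DComp → DComp → (DComp → DComp → Carrier) → Carrier
  ∑⊴₂ X Y h = ∑ (coarsenings X) (λ δ → ∑ (coarsenings Y) (h δ))

  ∑⊴₂-zero : ∀ X Y h → (∀ {δ ε} → X ⊴ δ → Y ⊴ ε → h δ ε ≈ 0#) → ∑⊴₂ X Y h ≈ 0#
  ∑⊴₂-zero X Y h h≈0 = ∑-zero _ (λ δ∈ → ∑-zero _ (λ ε∈ → h≈0 (∈-coarsenings⁻ δ∈) (∈-coarsenings⁻ ε∈)))

  ∑⊴₂-single : ∀ X Y h {δ₀ ε₀} → X ⊴ δ₀ → Y ⊴ ε₀ →
    (∀ {δ ε} → X ⊴ δ → Y ⊴ ε → (δ , ε) ≢ (δ₀ , ε₀) → h δ ε ≈ 0#) → ∑⊴₂ X Y h ≈ h δ₀ ε₀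
  ∑⊴₂-single X Y h cX cY off = ≈-trans
    (∑-unique (coarsenings-unique X) (∈-coarsenings⁺ cX)
      (λ δ∈ δ≢δ₀ → ∑-zero _ (λ ε∈ → off (∈-coarsenings⁻ δ∈) (∈-coarsenings⁻ ε∈) (δ≢δ₀ ∘ cong proj₁))))
    (∑-unique (coarsenings-unique Y) (∈-coarsenings⁺ cY) (λ ε∈ ε≢ε₀ → off cX (∈-coarsenings⁻ ε∈) (ε≢ε₀ ∘ cong proj₂)))

  •-count-zero : ∀ X Y γ → (∀ {δ ε} → X ⊴ δ → Y ⊴ ε → δ ++ ε ≢ γ) → ∑⊴₂ X Y (•ᵀ (M* γ)) ≈ 0#
  •-count-zero X Y γ ≢γ = ∑⊴₂-zero X Y _ (λ cX cY → M*-other (≢γ cX cY))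

  •-count-one : ∀ X Y {δ₀ ε₀} → X ⊴ δ₀ → Y ⊴ ε₀ → ∑⊴₂ X Y (•ᵀ (M* (δ₀ ++ ε₀))) ≈ 1#
  •-count-one X Y {δ₀} {ε₀} cX cY =
    ≈-trans (∑⊴₂-single X Y _ cX cY (λ cX′ _ ne → M*-other (ne ∘ ⊴-++-unique cX′ cX))) (M*-self (δ₀ ++ ε₀))

  ⊙-count-zero : ∀ X Y γ → (∀ {δ ε} → X ⊴ δ → Y ⊴ ε → ¬ NearConcat δ ε γ) → ∑⊴₂ X Y (⊙ᵀ (M* γ)) ≈ 0#
  ⊙-count-zero X Y γ ¬NC =
    ∑⊴₂-zero X Y _ (λ {δ} {ε} cX cY →
      ⊙ᵀ-zero (M* γ) δ ε (λ {γ′} v → M*-other {γ′} {γ} (λ { refl → ¬NC cX cY v })))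

  ⊙-count-one : ∀ X Y γ {δ₀ ε₀} → X ⊴ δ₀ → Y ⊴ ε₀ → NearConcat δ₀ ε₀ γ → ∑⊴₂ X Y (⊙ᵀ (M* γ)) ≈ 1#
  ⊙-count-one X Y γ {δ₀} {ε₀} cX cY v₀ = begin
    ∑⊴₂ X Y (⊙ᵀ (M* γ))  ≈⟨ ∑⊴₂-single X Y _ cX cY off ⟩
    ⊙ᵀ (M* γ) δ₀ ε₀      ≡⟨ ⊙ᵀ-NC (M* γ) v₀ ⟩
    M* γ γ               ≈⟨ M*-self γ ⟩
    1#                   ∎
    where
    off : ∀ {δ ε} → X ⊴ δ → Y ⊴ ε → (δ , ε) ≢ (δ₀ , ε₀) → ⊙ᵀ (M* γ) δ ε ≈ 0#
    off {δ} {ε} cX′ _ ne =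
      ⊙ᵀ-zero (M* γ) δ ε (λ {γ′} v → M*-other {γ′} {γ} (λ { refl → ne (⊴-NC-unique cX′ cX v v₀) }))

  ∑-coarsenings-++ : ∀ X Y γ → ∑ (coarsenings (X ++ Y)) (M* γ) ≈ ∑⊴₂ X Y (•ᵀ (M* γ)) +R ∑⊴₂ X Y (⊙ᵀ (M* γ))
  ∑-coarsenings-++ X Y γ with γ ∈? coarsenings (X ++ Y)
  ... | no γ∉ = begin
    ∑ (coarsenings (X ++ Y)) (M* γ)   ≈⟨ ∑-M*-∉ γ∉ ⟩
    0#                                ≈⟨ +-identityˡ 0# ⟨
    0# +R 0#                          ≈⟨ +-cong (•-count-zero X Y γ ¬•) (⊙-count-zero X Y γ ¬⊙) ⟨
    _                                 ∎
    where
    ¬• : ∀ {δ ε} → X ⊴ δ → Y ⊴ ε → δ ++ ε ≢ γ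
    ¬• cX cY refl = γ∉ (∈-coarsenings⁺ (⊴-++ cX cY))
    ¬⊙ : ∀ {δ ε} → X ⊴ δ → Y ⊴ ε → ¬ NearConcat δ ε γ
    ¬⊙ cX cY v = γ∉ (∈-coarsenings⁺ (⊴-NC-++ cX cY v))
  ... | yes γ∈ with ⊴-split-++ X (∈-coarsenings⁻ γ∈)
  ...   | inj₁ (δ₀ , ε₀ , cX , cY , refl) = begin
    ∑ (coarsenings (X ++ Y)) (M* γ)   ≈⟨ ∑-M*-∈ (coarsenings-unique (X ++ Y)) γ∈ ⟩
    1#                                ≈⟨ +-identityʳ 1# ⟨
    1# +R 0#                          ≈⟨ +-cong (•-count-one X Y cX cY)
                                                (⊙-count-zero X Y γ (λ cX′ _ → ⊴-++≢NC cX cX′ refl)) ⟨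
    _                                 ∎
  ...   | inj₂ (δ₀ , ε₀ , cX , cY , v₀) = begin
    ∑ (coarsenings (X ++ Y)) (M* γ)   ≈⟨ ∑-M*-∈ (coarsenings-unique (X ++ Y)) γ∈ ⟩
    1#                                ≈⟨ +-identityˡ 1# ⟨
    0# +R 1#                          ≈⟨ +-cong (•-count-zero X Y γ (λ cX′ _ e → ⊴-++≢NC cX′ cX e v₀))
                                                (⊙-count-one X Y γ cX cY v₀) ⟨
    _                                 ∎

  ∑-coarsenings-NC : ∀ {X Y Z} → NearConcat X Y Z → ∀ γ → ∑ (coarsenings Z) (M* γ) ≈ ∑⊴₂ X Y (⊙ᵀ (M* γ))
  ∑-coarsenings-NC {X} {Y} {Z} v γ with γ ∈? coarsenings Z
  ... | no γ∉ = ≈-trans (∑-M*-∉ γ∉) (≈-sym (⊙-count-zero X Y γ ¬NC))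
    where
    ¬NC : ∀ {δ ε} → X ⊴ δ → Y ⊴ ε → ¬ NearConcat δ ε γ
    ¬NC cX cY w with ⊴-NC cX cY w
    ... | ζ , v′ , c with refl ← NC-deterministic v v′ = γ∉ (∈-coarsenings⁺ c)
  ... | yes γ∈ with ⊴-split-NC v (∈-coarsenings⁻ γ∈)
  ...   | δ₀ , ε₀ , cX , cY , v₀ =
    ≈-trans (∑-M*-∈ (coarsenings-unique Z) γ∈) (≈-sym (⊙-count-one X Y γ cX cY v₀))

  neg1^-+ : ∀ m n → neg1^ (m + n) ≈ neg1^ m *R neg1^ n
  neg1^-+ zero n = ≈-sym (*-identityˡ _)
  neg1^-+ (suc m) n = ≈-trans (-‿cong (neg1^-+ m n)) (-‿distribˡ-* _ _)

  neg1^-double : ∀ k n → neg1^ (k + k + n) ≈ neg1^ n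
  neg1^-double zero n = ≈-refl
  neg1^-double (suc k) n = begin
    neg1^ (suc k + suc k + n)   ≡⟨ cong (λ e → neg1^ (suc (e + n))) (ℕ.+-suc k k) ⟩
    - - neg1^ (k + k + n)       ≈⟨ -‿involutive _ ⟩
    neg1^ (k + k + n)           ≈⟨ neg1^-double k n ⟩
    neg1^ n                     ∎

  -- k is the number of parts lost in forming γ; the factor (-1)^(k+k) avoids truncated subtraction.
  sign-split : ∀ k α β γ → length γ + k ≡ length α + length β → fdeg γ ≡ fdeg α + fdeg β →
    sign γ ≈ neg1^ (fdeg α * fdeg β + k) *R (sign β *R sign α)
  sign-split k α β γ len deg = begin
    sign γ                                        ≈⟨ neg1^-double k _ ⟨
    neg1^ (k + k + (length γ + fdeg γ C 2))       ≡⟨ cong (λ m → neg1^ (k + k + (length γ + m C 2))) deg ⟩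
    neg1^ (k + k + (length γ + (ma + mb) C 2))    ≡⟨ cong neg1^ (exponent-split k (length γ) la lb ma mb len) ⟩
    neg1^ (ma * mb + k + (lb + mb C 2 + (la + ma C 2)))        ≈⟨ neg1^-+ (ma * mb + k) _ ⟩
    neg1^ (ma * mb + k) *R neg1^ (lb + mb C 2 + (la + ma C 2)) ≈⟨ *-congˡ (neg1^-+ (lb + mb C 2) (la + ma C 2)) ⟩
    neg1^ (ma * mb + k) *R (sign β *R sign α)     ∎
    where
    la = length α
    lb = length β
    ma = fdeg α
    mb = fdeg β

  Sᵀ₂-formula : ∀ h α β → Sᵀ₂ h α β ≈ (sign β *R sign α) *R ∑⊴₂ (reverse β) (reverse α) h
  Sᵀ₂-formula h α β =
    ≈-trans (*-congˡ (∑-*ˡ (coarsenings (reverse β)) (sign α) _)) (≈-sym (*-assoc (sign β) (sign α) _))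

  Sᵀ-++ : ∀ α β γ → Sᵀ (M* γ) (α ++ β) ≈ neg1^ (fdeg α * fdeg β) *R (Sᵀ₂ (•ᵀ (M* γ)) α β +R Sᵀ₂ (⊙ᵀ (M* γ)) α β)
  Sᵀ-++ α β γ = begin
    sign (α ++ β) *R ∑ (coarsenings (reverse (α ++ β))) (M* γ)
      ≡⟨ cong (λ ζ → sign (α ++ β) *R ∑ (coarsenings ζ) (M* γ)) (reverse-++ α β) ⟩
    sign (α ++ β) *R ∑ (coarsenings (reverse β ++ reverse α)) (M* γ)
      ≈⟨ *-cong (sign-split 0 α β (α ++ β) len (fdeg-++ α β)) (∑-coarsenings-++ (reverse β) (reverse α) γ) ⟩
    (neg1^ (fdeg α * fdeg β + 0) *R sβα) *R (∑• +R ∑⊙)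
      ≡⟨ cong (λ m → (neg1^ m *R sβα) *R (∑• +R ∑⊙)) (ℕ.+-identityʳ (fdeg α * fdeg β)) ⟩
    (neg1^ (fdeg α * fdeg β) *R sβα) *R (∑• +R ∑⊙)
      ≈⟨ ≈-trans (*-assoc _ _ _) (*-congˡ (distribˡ sβα ∑• ∑⊙)) ⟩
    neg1^ (fdeg α * fdeg β) *R (sβα *R ∑• +R sβα *R ∑⊙)
      ≈⟨ *-congˡ (+-cong (Sᵀ₂-formula _ α β) (Sᵀ₂-formula _ α β)) ⟨
    neg1^ (fdeg α * fdeg β) *R (Sᵀ₂ (•ᵀ (M* γ)) α β +R Sᵀ₂ (⊙ᵀ (M* γ)) α β) ∎
    where
    len = trans (ℕ.+-identityʳ _) (length-++ α)
    sβα = sign β *R sign α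
    ∑• = ∑⊴₂ (reverse β) (reverse α) (•ᵀ (M* γ))
    ∑⊙ = ∑⊴₂ (reverse β) (reverse α) (⊙ᵀ (M* γ))

  Sᵀ-⊙ : ∀ α β γ → ⊙ᵀ (Sᵀ (M* γ)) α β ≈ neg1^ (fdeg α * fdeg β + 1) *R Sᵀ₂ (⊙ᵀ (M* γ)) α β
  Sᵀ-⊙ α β γ with nearConcat α β in eq
  ... | just μ = begin
    sign μ *R ∑ (coarsenings (reverse μ)) (M* γ)
      ≈⟨ *-cong (sign-split 1 α β μ (trans (ℕ.+-comm _ 1) (NC-length v)) (NC-fdeg v))
                (∑-coarsenings-NC (NC-reverse v) γ) ⟩
    (neg1^ (fdeg α * fdeg β + 1) *R (sign β *R sign α)) *R ∑⊴₂ (reverse β) (reverse α) (⊙ᵀ (M* γ))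
      ≈⟨ *-assoc _ _ _ ⟩
    neg1^ (fdeg α * fdeg β + 1) *R ((sign β *R sign α) *R ∑⊴₂ (reverse β) (reverse α) (⊙ᵀ (M* γ)))
      ≈⟨ *-congˡ (Sᵀ₂-formula _ α β) ⟨
    neg1^ (fdeg α * fdeg β + 1) *R Sᵀ₂ (⊙ᵀ (M* γ)) α β ∎
    where
    v = nearConcat⇒NC α β eq
  ... | nothing = ≈-sym (begin
    neg1^ (fdeg α * fdeg β + 1) *R Sᵀ₂ (⊙ᵀ (M* γ)) α β
      ≈⟨ *-congˡ (Sᵀ₂-formula _ α β) ⟩
    neg1^ (fdeg α * fdeg β + 1) *R ((sign β *R sign α) *R ∑⊴₂ (reverse β) (reverse α) (⊙ᵀ (M* γ)))
      ≈⟨ *-congˡ (*-congˡ (⊙-count-zero (reverse β) (reverse α) γ ¬NC)) ⟩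
    neg1^ (fdeg α * fdeg β + 1) *R ((sign β *R sign α) *R 0#)
      ≈⟨ ≈-trans (*-congˡ (zeroʳ _)) (zeroʳ _) ⟩
    0# ∎)
    where
    ¬NC : ∀ {δ ε} → reverse β ⊴ δ → reverse α ⊴ ε → ¬ NearConcat δ ε γ
    ¬NC cβ cα w with ⊴-NC cβ cα w
    ... | ζ , v , _ with () ← trans (sym eq) (NC⇒nearConcat (NC-reverse⁻ α β v))

  S-• : ∀ {F G mF mG} → Homogeneous mF F → Homogeneous mG G →
    S (F • G) ≋ scale (neg1^ (mF * mG)) ((S G • S F) ⊕ (S G ⊙ S F))
  S-• {F} {G} {mF} {mG} hF hG = ≋-by-pairing (S (F • G)) (scale s ((S G • S F) ⊕ (S G ⊙ S F))) λ γ → begin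
    ⟨ S (F • G) ∣ M* γ ⟩
      ≈⟨ ≈-trans (pairing-S (F • G) (M* γ)) (pairing-• F G _) ⟩
    ⟨ F ⊗ G ∣ •ᵀ (Sᵀ (M* γ)) ⟩
      ≈⟨ pairing⊗-homogeneous F G hF hG
           (λ α β eα eβ → ≈-trans (Sᵀ-++ α β γ) (*-congʳ (reflexive (cong neg1^ (cong₂ _*_ eα eβ))))) ⟩
    ⟨ F ⊗ G ∣ (λ α β → s *R (Sᵀ₂ (•ᵀ (M* γ)) α β +R Sᵀ₂ (⊙ᵀ (M* γ)) α β)) ⟩
      ≈⟨ ≈-trans (pairing⊗-*ˡ F G s _) (*-congˡ (pairing⊗-+ F G _ _)) ⟩
    s *R (⟨ F ⊗ G ∣ Sᵀ₂ (•ᵀ (M* γ)) ⟩ +R ⟨ F ⊗ G ∣ Sᵀ₂ (⊙ᵀ (M* γ)) ⟩)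
      ≈⟨ *-congˡ (+-cong (pairing-S⊗S F G _) (pairing-S⊗S F G _)) ⟨
    s *R (⟨ S G ⊗ S F ∣ •ᵀ (M* γ) ⟩ +R ⟨ S G ⊗ S F ∣ ⊙ᵀ (M* γ) ⟩)
      ≈⟨ *-congˡ (+-cong (pairing-• (S G) (S F) _) (pairing-⊙ (S G) (S F) _)) ⟨
    s *R (⟨ S G • S F ∣ M* γ ⟩ +R ⟨ S G ⊙ S F ∣ M* γ ⟩)
      ≈⟨ ≈-trans (pairing-scale s ((S G • S F) ⊕ (S G ⊙ S F)) (M* γ))
                 (*-congˡ (pairing-⊕ (S G • S F) (S G ⊙ S F) (M* γ))) ⟨
    ⟨ scale s ((S G • S F) ⊕ (S G ⊙ S F)) ∣ M* γ ⟩ ∎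
    where
    s = neg1^ (mF * mG)

  S-⊙ : ∀ {F G mF mG} → Homogeneous mF F → Homogeneous mG G →
    S (F ⊙ G) ≋ scale (neg1^ (mF * mG + 1)) (S G ⊙ S F)
  S-⊙ {F} {G} {mF} {mG} hF hG = ≋-by-pairing (S (F ⊙ G)) (scale s (S G ⊙ S F)) λ γ → begin
    ⟨ S (F ⊙ G) ∣ M* γ ⟩
      ≈⟨ ≈-trans (pairing-S (F ⊙ G) (M* γ)) (pairing-⊙ F G _) ⟩
    ⟨ F ⊗ G ∣ ⊙ᵀ (Sᵀ (M* γ)) ⟩
      ≈⟨ pairing⊗-homogeneous F G hF hG
           (λ α β eα eβ → ≈-trans (Sᵀ-⊙ α β γ) (*-congʳ (reflexive (cong (λ m → neg1^ (m + 1)) (cong₂ _*_ eα eβ))))) ⟩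
    ⟨ F ⊗ G ∣ (λ α β → s *R Sᵀ₂ (⊙ᵀ (M* γ)) α β) ⟩
      ≈⟨ pairing⊗-*ˡ F G s _ ⟩
    s *R ⟨ F ⊗ G ∣ Sᵀ₂ (⊙ᵀ (M* γ)) ⟩
      ≈⟨ *-congˡ (≈-trans (pairing-⊙ (S G) (S F) _) (pairing-S⊗S F G _)) ⟨
    s *R ⟨ S G ⊙ S F ∣ M* γ ⟩
      ≈⟨ pairing-scale s (S G ⊙ S F) (M* γ) ⟨
    ⟨ scale s (S G ⊙ S F) ∣ M* γ ⟩ ∎
    where
    s = neg1^ (mF * mG + 1)

mainTheorem4 : ∀ {c ℓ : Level} (R : CommutativeRing c ℓ) →
    let open sQSym R in
    ∀ (F G : Elem) (mF mG : ℕ) → Homogeneous mF F → Homogeneous mG G →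
      (S (F • G) ≋ scale (neg1^ (mF * mG)) ((S G • S F) ⊕ (S G ⊙ S F)))
      × (S (F ⊙ G) ≋ scale (neg1^ (mF * mG + 1)) (S G ⊙ S F))
mainTheorem4 R F G mF mG hF hG = Antipode.S-• R {F} {G} hF hG , Antipode.S-⊙ R {F} {G} hF hG
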